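{- Let $s\ge2$, $k\ge1$, $0\le t\le k$ and $\lambda\ge1$ be integers, and define $a_0=\lambda$ and $a_c=\lambda-\sum_{e=0}^{c-1}a_e\binom{k-t}{c-e}(s-1)^{c-e}$ for $c\ge1$. If $k-t\ge2$, then $a_0,a_1,\dots,a_t$ are all non-zero and pairwise distinct. -}

module Defs where

open import Data.Nat using (ℕ; zero; suc; _∸_; _^_)
open import Data.Nat.Combinatorics using (_C_)
open import Data.Integer as ℤ using (ℤ; +_)
open import Data.List using (List; []; _∷_; _++_; [_]; foldr; zipWith; upTo; length)

sumℤ : List ℤ → ℤ
sumℤ = foldr ℤ._+_ (+ 0)

term : (s k t : ℕ) → (c e : ℕ) → ℤ → ℤ
term s k t c e ae = ae ℤ.* (+ (((k ∸ t) C (c ∸ e)) ℕ.* ((s ∸ 1) ^ (c ∸ e))))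
  where import Data.Nat as ℕ

-- next value a_c given the list [a_0, …, a_{c-1}] (of length c)
next : (s k t : ℕ) → (l : ℤ) → (c : ℕ) → List ℤ → ℤ
next s k t l c prev = l ℤ.- sumℤ (zipWith (term s k t c) (upTo c) prev)

prefix : (s k t : ℕ) → (l : ℤ) → ℕ → List ℤ
prefix s k t l zero = []
prefix s k t l (suc c) = prefix s k t l c ++ [ next s k t l c (prefix s k t l c) ]

a : (s k t : ℕ) → (l : ℤ) → ℕ → ℤ
a s k t l c = next s k t l c (prefix s k t l c)

module Submission where

-- Write q = s - 1 ≥ 1, m = k - t ≥ 2 and w_m(i) = C(m,i) qⁱ, the coefficients of
-- (1 + q x)ᵐ.  The recurrence defining a_c says exactly that
--   Σ_{e ≤ c} a_e w_m(c - e) = λ   for every c,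
-- i.e. A(x) (1 + q x)ᵐ = λ / (1 - x) for the generating series A of (a_c).
-- Hence a_c = H_m(c) := λ Σ_{i ≤ c} (-1)ⁱ C(m+i-1, i) qⁱ, the partial sums of
-- λ (1 + q x)^(-m).  We verify this closed form without power series: writing D
-- for multiplication by 1 + q x, the Pascal rule gives D H_{m+1} = H_m and
-- (F ⋆ w_{m+1}) = (D F) ⋆ w_m, so H_m ⋆ w_m = H_0 ⋆ w_0 = λ; solutions of the
-- recurrence are unique.  Finally, for m ≥ 2 and q ≥ 1 the magnitudes
-- L_i = λ C(m+i-1, i) qⁱ are positive and strictly increasing, and alternating
-- partial sums of such a sequence are non-zero and pairwise distinct.

open import Defs
open import Data.Nat as ℕ using (ℕ; zero; suc; _≤_; _<_; _∸_; _^_; z≤n; s≤s)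
import Data.Nat.Properties as ℕP
open import Data.Nat.Combinatorics using (_C_; nCk+nC[k+1]≡[n+1]C[k+1]; k>n⇒nCk≡0)
open import Data.Nat.Induction using (<-rec)
open import Data.Integer as ℤ using (ℤ; +_; _+_; _*_; -_; _-_)
import Data.Integer.Properties as ℤP
import Data.Integer.Tactic.RingSolver as ℤSolver
import Data.Nat.Tactic.RingSolver as ℕSolver
open import Data.List using ([]; _∷_; _++_; [_]; zipWith; upTo; map)
import Data.List.Properties as ListP
open import Data.Product using (_×_; _,_)
open import Data.Empty using (⊥-elim)
open import Relation.Binary.Definitions using (tri<; tri≈; tri>)
open import Relation.Binary.PropositionalEquality hiding ([_])

sumTo : ℕ → (ℕ → ℤ) → ℤ
sumTo zero    f = + 0
sumTo (suc n) f = sumTo n f + f n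

sumTo-cong : ∀ n {f g : ℕ → ℤ} → (∀ i → i < n → f i ≡ g i) → sumTo n f ≡ sumTo n g
sumTo-cong zero    f≡g = refl
sumTo-cong (suc n) f≡g =
  cong₂ _+_ (sumTo-cong n (λ i i<n → f≡g i (ℕP.m<n⇒m<1+n i<n))) (f≡g n ℕP.≤-refl)

sumTo-+ : ∀ n (f g : ℕ → ℤ) → sumTo n (λ i → f i + g i) ≡ sumTo n f + sumTo n g
sumTo-+ zero    f g = refl
sumTo-+ (suc n) f g = trans (cong (_+ (f n + g n)) (sumTo-+ n f g))
                            (interchange (sumTo n f) (sumTo n g) (f n) (g n))
  where
  interchange : ∀ a b c d → (a + b) + (c + d) ≡ (a + c) + (b + d)
  interchange = ℤSolver.solve-∀

sumTo-*ˡ : ∀ n c (f : ℕ → ℤ) → sumTo n (λ i → c * f i) ≡ c * sumTo n f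
sumTo-*ˡ zero    c f = sym (ℤP.*-zeroʳ c)
sumTo-*ˡ (suc n) c f = trans (cong (_+ c * f n) (sumTo-*ˡ n c f))
                             (sym (ℤP.*-distribˡ-+ c (sumTo n f) (f n)))

sumTo-zero : ∀ n (f : ℕ → ℤ) → (∀ i → i < n → f i ≡ + 0) → sumTo n f ≡ + 0
sumTo-zero zero    f f≡0 = refl
sumTo-zero (suc n) f f≡0 =
  cong₂ _+_ (sumTo-zero n f (λ i i<n → f≡0 i (ℕP.m<n⇒m<1+n i<n))) (f≡0 n ℕP.≤-refl)

sumℤ-++ : ∀ xs ys → sumℤ (xs ++ ys) ≡ sumℤ xs + sumℤ ys
sumℤ-++ []       ys = sym (ℤP.+-identityˡ _)
sumℤ-++ (x ∷ xs) ys = trans (cong (_+_ x) (sumℤ-++ xs ys)) (sym (ℤP.+-assoc x (sumℤ xs) (sumℤ ys)))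

sumℤ-map-upTo : ∀ n (f : ℕ → ℤ) → sumℤ (map f (upTo n)) ≡ sumTo n f
sumℤ-map-upTo zero    f = refl
sumℤ-map-upTo (suc n) f = begin
  sumℤ (map f (upTo (suc n)))      ≡⟨ cong (λ xs → sumℤ (map f xs)) (sym (ListP.upTo-∷ʳ n)) ⟩
  sumℤ (map f (upTo n ++ [ n ]))   ≡⟨ cong sumℤ (ListP.map-++ f (upTo n) [ n ]) ⟩
  sumℤ (map f (upTo n) ++ [ f n ]) ≡⟨ sumℤ-++ (map f (upTo n)) [ f n ] ⟩
  sumℤ (map f (upTo n)) + (f n + + 0) ≡⟨ cong₂ _+_ (sumℤ-map-upTo n f) (ℤP.+-identityʳ (f n)) ⟩
  sumTo n f + f n                  ∎
  where open ≡-Reasoning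

zipWith-map-diagonal : ∀ {A B C : Set} (f : A → B → C) (g : A → B) xs →
                       zipWith f xs (map g xs) ≡ map (λ x → f x (g x)) xs
zipWith-map-diagonal f g []       = refl
zipWith-map-diagonal f g (x ∷ xs) = cong (f x (g x) ∷_) (zipWith-map-diagonal f g xs)

module _ (s k t : ℕ) (l : ℤ) where

  prefix-map : ∀ c → prefix s k t l c ≡ map (a s k t l) (upTo c)
  prefix-map zero    = refl
  prefix-map (suc c) = begin
    prefix s k t l c ++ [ a s k t l c ]                ≡⟨ cong (_++ [ a s k t l c ]) (prefix-map c) ⟩
    map (a s k t l) (upTo c) ++ map (a s k t l) [ c ]  ≡⟨ sym (ListP.map-++ (a s k t l) (upTo c) [ c ]) ⟩
    map (a s k t l) (upTo c ++ [ c ])                  ≡⟨ cong (map (a s k t l)) (ListP.upTo-∷ʳ c) ⟩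
    map (a s k t l) (upTo (suc c))                     ∎
    where open ≡-Reasoning

  a-recurrence : ∀ c → a s k t l c ≡ l - sumTo c (λ e → term s k t c e (a s k t l e))
  a-recurrence c = cong (_-_ l) (begin
    sumℤ (zipWith (term s k t c) (upTo c) (prefix s k t l c))
      ≡⟨ cong (λ xs → sumℤ (zipWith (term s k t c) (upTo c) xs)) (prefix-map c) ⟩
    sumℤ (zipWith (term s k t c) (upTo c) (map (a s k t l) (upTo c)))
      ≡⟨ cong sumℤ (zipWith-map-diagonal (term s k t c) (a s k t l) (upTo c)) ⟩
    sumℤ (map (λ e → term s k t c e (a s k t l e)) (upTo c))
      ≡⟨ sumℤ-map-upTo c _ ⟩
    sumTo c (λ e → term s k t c e (a s k t l e)) ∎)
    where open ≡-Reasoning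

ε : ℕ → ℤ
ε zero          = + 1
ε (suc zero)    = - + 1
ε (suc (suc n)) = ε n

ε-suc : ∀ n → ε (suc n) ≡ - ε n
ε-suc zero          = refl
ε-suc (suc zero)    = refl
ε-suc (suc (suc n)) = ε-suc n

ε-flip : ∀ n → ε (suc n) ≢ ε n
ε-flip zero          ()
ε-flip (suc zero)    ()
ε-flip (suc (suc n)) = ε-flip n

∣ε*n∣ : ∀ i x → ℤ.∣ ε i * + x ∣ ≡ x
∣ε*n∣ i x = trans (ℤP.abs-* (ε i) (+ x)) (trans (cong (ℕ._* x) (∣ε∣ i)) (ℕP.*-identityˡ x))
  where
  ∣ε∣ : ∀ i → ℤ.∣ ε i ∣ ≡ 1
  ∣ε∣ zero          = refl
  ∣ε∣ (suc zero)    = refl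
  ∣ε∣ (suc (suc i)) = ∣ε∣ i

*-cancel-pos : ∀ i j x → 0 < x → i * + x ≡ j * + x → i ≡ j
*-cancel-pos i j (suc x) _ = ℤP.*-cancelʳ-≡ i j (+ suc x)

altSum : (ℕ → ℕ) → ℕ → ℤ
altSum L n = sumTo (suc n) (λ i → ε i * + L i)

module _ (L : ℕ → ℕ) (L₀-pos : 0 < L 0) (L-inc : ∀ n → L n < L (suc n)) where

  -- the magnitude of altSum L n, defined by the recursion it must satisfy
  mag : ℕ → ℕ
  mag zero    = L 0
  mag (suc n) = L (suc n) ∸ mag n

  -- invariant: 0 < mag n ≤ L n, so the truncated subtraction in mag never saturates
  mag-bounds : ∀ n → 0 < mag n × mag n ≤ L n
  mag-bounds zero    = L₀-pos , ℕP.≤-refl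
  mag-bounds (suc n) with mag-bounds n
  ... | _ , mag≤L = ℕP.m<n⇒0<n∸m (ℕP.≤-<-trans mag≤L (L-inc n)) , ℕP.m∸n≤m (L (suc n)) (mag n)

  mag≤next : ∀ n → mag n ≤ L (suc n)
  mag≤next n with mag-bounds n
  ... | _ , mag≤L = ℕP.≤-trans mag≤L (ℕP.<⇒≤ (L-inc n))

  altSum-sign : ∀ n → altSum L n ≡ ε n * + mag n
  altSum-sign zero    = ℤP.+-identityˡ _
  altSum-sign (suc n) = begin
    altSum L n + ε (suc n) * + L (suc n)    ≡⟨ cong₂ (λ x y → x + y * + L (suc n)) (altSum-sign n) (ε-suc n) ⟩
    ε n * + mag n + - ε n * + L (suc n)     ≡⟨ regroup (ε n) (+ mag n) (+ L (suc n)) ⟩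
    - ε n * (+ L (suc n) - + mag n)         ≡⟨ cong₂ _*_ (sym (ε-suc n)) (sym (+-∸ (mag≤next n))) ⟩
    ε (suc n) * + mag (suc n)               ∎
    where
    open ≡-Reasoning
    regroup : ∀ e x y → e * x + - e * y ≡ - e * (y - x)
    regroup = ℤSolver.solve-∀
    +-∸ : ∀ {x y} → y ≤ x → + (x ∸ y) ≡ + x - + y
    +-∸ {x} {y} y≤x = sym (trans (ℤP.m-n≡m⊖n x y) (ℤP.⊖-≥ y≤x))

  -- two steps apart, the magnitude strictly grows: mag (n+2) = L(n+2) - L(n+1) + mag n
  mag-step2 : ∀ n → mag n < mag (suc (suc n))
  mag-step2 n = ℕP.m+n≤o⇒m≤o∸n (suc (mag n)) (subst (λ z → suc z ≤ L (suc (suc n))) sum≡ (L-inc (suc n)))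
    where
    sum≡ : L (suc n) ≡ mag n ℕ.+ mag (suc n)
    sum≡ = sym (ℕP.m+[n∸m]≡n (mag≤next n))

  mag-grows : ∀ j c → ε (suc j ℕ.+ c) ≡ ε c → mag c < mag (suc j ℕ.+ c)
  mag-grows zero          c e = ⊥-elim (ε-flip c e)
  mag-grows (suc zero)    c _ = mag-step2 c
  mag-grows (suc (suc j)) c e = ℕP.<-trans (mag-grows j c e) (mag-step2 (suc j ℕ.+ c))

  altSum-nonzero : ∀ n → altSum L n ≢ + 0
  altSum-nonzero n eq with mag-bounds n
  ... | mag-pos , _ = ℕP.<⇒≢ mag-pos (sym mag≡0)
    where
    mag≡0 : mag n ≡ 0
    mag≡0 = trans (sym (∣ε*n∣ n (mag n))) (cong ℤ.∣_∣ (trans (sym (altSum-sign n)) eq))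

  sign-and-magnitude : ∀ c d → altSum L c ≡ altSum L d → ε c ≡ ε d × mag c ≡ mag d
  sign-and-magnitude c d eq with mag-bounds c
  ... | mag-pos , _ = *-cancel-pos (ε c) (ε d) (mag c) mag-pos same-magnitude , mag≡
    where
    eq′ : ε c * + mag c ≡ ε d * + mag d
    eq′ = trans (sym (altSum-sign c)) (trans eq (altSum-sign d))
    mag≡ : mag c ≡ mag d
    mag≡ = trans (sym (∣ε*n∣ c (mag c))) (trans (cong ℤ.∣_∣ eq′) (∣ε*n∣ d (mag d)))
    same-magnitude : ε c * + mag c ≡ ε d * + mag c
    same-magnitude = subst (λ z → ε c * + mag c ≡ ε d * + z) (sym mag≡) eq′

  altSum-earlier : ∀ c d → c < d → altSum L c ≢ altSum L d
  altSum-earlier c d c<d eq with sign-and-magnitude c d eq | ℕP.m≤n⇒∃[o]m+o≡n c<d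
  ... | εc≡εd , mag≡ | j , c+1+j≡d =
    ℕP.<⇒≢ (mag-grows j c (trans (cong ε (sym d≡)) (sym εc≡εd))) (trans mag≡ (cong mag d≡))
    where
    d≡ : d ≡ suc j ℕ.+ c
    d≡ = trans (sym c+1+j≡d) (cong suc (ℕP.+-comm c j))

  altSum-injective : ∀ c d → altSum L c ≡ altSum L d → c ≡ d
  altSum-injective c d eq with ℕP.<-cmp c d
  ... | tri< c<d _ _ = ⊥-elim (altSum-earlier c d c<d eq)
  ... | tri≈ _ c≡d _ = c≡d
  ... | tri> _ _ d<c = ⊥-elim (altSum-earlier d c d<c (sym eq))

-- Convolution of sequences and multiplication by 1 + q x

conv : (ℕ → ℤ) → (ℕ → ℤ) → ℕ → ℤ
conv F g n = sumTo (suc n) (λ i → F i * g (n ∸ i))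

conv-congˡ : ∀ {F G} g → (∀ n → F n ≡ G n) → ∀ n → conv F g n ≡ conv G g n
conv-congˡ g F≡G n = sumTo-cong (suc n) (λ i _ → cong (_* g (n ∸ i)) (F≡G i))

conv-congʳ : ∀ F {g h} → (∀ n → g n ≡ h n) → ∀ n → conv F g n ≡ conv F h n
conv-congʳ F g≡h n = sumTo-cong (suc n) (λ i _ → cong (F i *_) (g≡h (n ∸ i)))

conv-unit : ∀ F (δ : ℕ → ℤ) → δ 0 ≡ + 1 → (∀ j → δ (suc j) ≡ + 0) → ∀ n → conv F δ n ≡ F n
conv-unit F δ δ₀ δₛ n = begin
  sumTo n (λ i → F i * δ (n ∸ i)) + F n * δ (n ∸ n)
    ≡⟨ cong₂ _+_ (sumTo-zero n _ vanish) (cong (λ j → F n * δ j) (ℕP.n∸n≡0 n)) ⟩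
  + 0 + F n * δ 0    ≡⟨ ℤP.+-identityˡ _ ⟩
  F n * δ 0          ≡⟨ trans (cong (F n *_) δ₀) (ℤP.*-identityʳ (F n)) ⟩
  F n                ∎
  where
  open ≡-Reasoning
  vanish : ∀ i → i < n → F i * δ (n ∸ i) ≡ + 0
  vanish i i<n with n ∸ i | ℕP.m<n⇒0<n∸m i<n
  ... | suc j | _ = trans (cong (F i *_) (δₛ j)) (ℤP.*-zeroʳ (F i))

module _ (q : ℕ) where

  -- multiplication of a power series by 1 + q x
  D : (ℕ → ℤ) → ℕ → ℤ
  D F zero    = F zero
  D F (suc n) = F (suc n) + + q * F n

  D-cong : ∀ {F G} → (∀ n → F n ≡ G n) → ∀ n → D F n ≡ D G n
  D-cong F≡G zero    = F≡G zero
  D-cong F≡G (suc n) = cong₂ (λ x y → x + + q * y) (F≡G (suc n)) (F≡G n)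

  conv-D : ∀ F g n → conv F (D g) n ≡ D (conv F g) n
  conv-D F g zero    = refl
  conv-D F g (suc n) = begin
    sumTo (suc n) (λ i → F i * D g (suc n ∸ i)) + F (suc n) * D g (suc n ∸ suc n)
      ≡⟨ cong₂ _+_ (sumTo-cong (suc n) (λ i i≤n → split i (ℕP.<⇒≤pred i≤n)))
                   (cong (λ j → F (suc n) * D g j) (ℕP.n∸n≡0 n)) ⟩
    sumTo (suc n) (λ i → F i * g (suc n ∸ i) + + q * (F i * g (n ∸ i))) + F (suc n) * g 0
      ≡⟨ cong (_+ F (suc n) * g 0) (sumTo-+ (suc n) _ _) ⟩
    (shifted + sumTo (suc n) (λ i → + q * (F i * g (n ∸ i)))) + F (suc n) * g 0
      ≡⟨ cong (λ z → (shifted + z) + F (suc n) * g 0) (sumTo-*ˡ (suc n) (+ q) _) ⟩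
    (shifted + + q * conv F g n) + F (suc n) * g 0
      ≡⟨ swap-last shifted _ _ ⟩
    (shifted + F (suc n) * g 0) + + q * conv F g n
      ≡⟨ cong (λ j → (shifted + F (suc n) * g j) + + q * conv F g n) (sym (ℕP.n∸n≡0 n)) ⟩
    D (conv F g) (suc n) ∎
    where
    open ≡-Reasoning
    shifted : ℤ
    shifted = sumTo (suc n) (λ i → F i * g (suc n ∸ i))
    swap-last : ∀ x y z → (x + y) + z ≡ (x + z) + y
    swap-last = ℤSolver.solve-∀
    distribute : ∀ f x y z → f * (x + y * z) ≡ f * x + y * (f * z)
    distribute = ℤSolver.solve-∀
    split : ∀ i → i ≤ n → F i * D g (suc n ∸ i) ≡ F i * g (suc n ∸ i) + + q * (F i * g (n ∸ i))
    split i i≤n rewrite ℕP.+-∸-assoc 1 i≤n = distribute (F i) (g (suc (n ∸ i))) (+ q) (g (n ∸ i))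

  w : ℕ → ℕ → ℤ
  w m i = + ((m C i) ℕ.* q ^ i)

  w-suc : ∀ m i → w (suc m) i ≡ D (w m) i
  w-suc m zero    = refl
  w-suc m (suc i) = begin
    + ((suc m C suc i) ℕ.* q ^ suc i)
      ≡⟨ cong (λ z → + (z ℕ.* q ^ suc i)) (sym (nCk+nC[k+1]≡[n+1]C[k+1] m i)) ⟩
    + ((m C i ℕ.+ m C suc i) ℕ.* (q ℕ.* q ^ i))
      ≡⟨ cong +_ (regroup (m C i) (m C suc i) q (q ^ i)) ⟩
    + ((m C suc i) ℕ.* q ^ suc i ℕ.+ q ℕ.* ((m C i) ℕ.* q ^ i))
      ≡⟨ ℤP.pos-+ ((m C suc i) ℕ.* q ^ suc i) (q ℕ.* ((m C i) ℕ.* q ^ i)) ⟩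
    + ((m C suc i) ℕ.* q ^ suc i) + + (q ℕ.* ((m C i) ℕ.* q ^ i))
      ≡⟨ cong (_+_ (+ ((m C suc i) ℕ.* q ^ suc i))) (ℤP.pos-* q ((m C i) ℕ.* q ^ i)) ⟩
    D (w m) (suc i) ∎
    where
    open ≡-Reasoning
    regroup : ∀ x y r R → (x ℕ.+ y) ℕ.* (r ℕ.* R) ≡ y ℕ.* (r ℕ.* R) ℕ.+ r ℕ.* (x ℕ.* R)
    regroup = ℕSolver.solve-∀

  conv-w-suc : ∀ m F n → conv F (w (suc m)) n ≡ conv (D F) (w m) n
  conv-w-suc zero F n = begin
    conv F (w 1) n       ≡⟨ conv-congʳ F (w-suc 0) n ⟩
    conv F (D (w 0)) n   ≡⟨ conv-D F (w 0) n ⟩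
    D (conv F (w 0)) n   ≡⟨ D-cong (conv-unit F (w 0) refl (λ _ → refl)) n ⟩
    D F n                ≡⟨ sym (conv-unit (D F) (w 0) refl (λ _ → refl) n) ⟩
    conv (D F) (w 0) n   ∎
    where open ≡-Reasoning
  conv-w-suc (suc m) F n = begin
    conv F (w (suc (suc m))) n   ≡⟨ conv-congʳ F (w-suc (suc m)) n ⟩
    conv F (D (w (suc m))) n     ≡⟨ conv-D F (w (suc m)) n ⟩
    D (conv F (w (suc m))) n     ≡⟨ D-cong (conv-w-suc m F) n ⟩
    D (conv (D F) (w m)) n       ≡⟨ sym (conv-D (D F) (w m) n) ⟩
    conv (D F) (D (w m)) n       ≡⟨ sym (conv-congʳ (D F) (w-suc m) n) ⟩
    conv (D F) (w (suc m)) n     ∎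
    where open ≡-Reasoning

-- The closed form: partial sums of λ (1 + q x)^(-m)

module _ (q : ℕ) where

  -- the absolute value C(m+n-1, n) qⁿ of the coefficient of xⁿ in (1 + q x)^(-m)
  u : ℕ → ℕ → ℕ
  u m n = (((m ℕ.+ n) ∸ 1) C n) ℕ.* q ^ n

  u-pascal : ∀ m n → u (suc m) (suc n) ≡ u m (suc n) ℕ.+ q ℕ.* u (suc m) n
  u-pascal m n rewrite ℕP.+-suc m n =
    trans (cong (λ z → z ℕ.* (q ℕ.* q ^ n)) (sym (nCk+nC[k+1]≡[n+1]C[k+1] (m ℕ.+ n) n)))
          (regroup ((m ℕ.+ n) C n) ((m ℕ.+ n) C suc n) q (q ^ n))
    where
    regroup : ∀ x y r R → (x ℕ.+ y) ℕ.* (r ℕ.* R) ≡ y ℕ.* (r ℕ.* R) ℕ.+ r ℕ.* (x ℕ.* R)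
    regroup = ℕSolver.solve-∀

module _ (q l : ℕ) where

  H : ℕ → ℕ → ℤ
  H m = altSum (λ i → l ℕ.* u q m i)

  signedTerm : ℕ → ℕ → ℤ
  signedTerm m i = ε i * + (l ℕ.* u q m i)

  term-pascal : ∀ m n → signedTerm (suc m) (suc n) + + q * signedTerm (suc m) n ≡ signedTerm m (suc n)
  term-pascal m n = begin
    ε (suc n) * + (l ℕ.* u q (suc m) (suc n)) + + q * (ε n * + (l ℕ.* u q (suc m) n))
      ≡⟨ cong₂ (λ e z → e * z + + q * (ε n * + (l ℕ.* u q (suc m) n))) (ε-suc n) lifted ⟩
    - ε n * (+ (l ℕ.* u q m (suc n)) + + q * + (l ℕ.* u q (suc m) n)) + + q * (ε n * + (l ℕ.* u q (suc m) n))
      ≡⟨ cancel (ε n) (+ (l ℕ.* u q m (suc n))) (+ q) (+ (l ℕ.* u q (suc m) n)) ⟩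
    - ε n * + (l ℕ.* u q m (suc n))
      ≡⟨ cong (_* + (l ℕ.* u q m (suc n))) (sym (ε-suc n)) ⟩
    ε (suc n) * + (l ℕ.* u q m (suc n)) ∎
    where
    open ≡-Reasoning
    cancel : ∀ e x r y → - e * (x + r * y) + r * (e * y) ≡ - e * x
    cancel = ℤSolver.solve-∀
    scale : ∀ c x y r → c ℕ.* (x ℕ.+ r ℕ.* y) ≡ c ℕ.* x ℕ.+ r ℕ.* (c ℕ.* y)
    scale = ℕSolver.solve-∀
    lifted : + (l ℕ.* u q (suc m) (suc n)) ≡ + (l ℕ.* u q m (suc n)) + + q * + (l ℕ.* u q (suc m) n)
    lifted = begin
      + (l ℕ.* u q (suc m) (suc n))
        ≡⟨ cong (λ z → + (l ℕ.* z)) (u-pascal q m n) ⟩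
      + (l ℕ.* (u q m (suc n) ℕ.+ q ℕ.* u q (suc m) n))
        ≡⟨ cong +_ (scale l (u q m (suc n)) (u q (suc m) n) q) ⟩
      + (l ℕ.* u q m (suc n) ℕ.+ q ℕ.* (l ℕ.* u q (suc m) n))
        ≡⟨ ℤP.pos-+ (l ℕ.* u q m (suc n)) (q ℕ.* (l ℕ.* u q (suc m) n)) ⟩
      + (l ℕ.* u q m (suc n)) + + (q ℕ.* (l ℕ.* u q (suc m) n))
        ≡⟨ cong (_+_ (+ (l ℕ.* u q m (suc n)))) (ℤP.pos-* q (l ℕ.* u q (suc m) n)) ⟩
      + (l ℕ.* u q m (suc n)) + + q * + (l ℕ.* u q (suc m) n) ∎

  D-H : ∀ m n → D q (H (suc m)) n ≡ H m n
  D-H m zero          = refl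
  D-H m (suc zero)    =
    trans (first (signedTerm m 0) (signedTerm (suc m) 1) (+ q)) (cong (_+_ (H m 0)) (term-pascal m 0))
    where
    first : ∀ x t r → (+ 0 + x + t) + r * (+ 0 + x) ≡ (+ 0 + x) + (t + r * x)
    first = ℤSolver.solve-∀
  D-H m (suc (suc n)) =
    trans (interchange (H (suc m) (suc n)) (signedTerm (suc m) (suc (suc n)))
                       (H (suc m) n) (signedTerm (suc m) (suc n)) (+ q))
          (cong₂ _+_ (D-H m (suc n)) (term-pascal m (suc n)))
    where
    interchange : ∀ x t y t′ r → (x + t) + r * (y + t′) ≡ (x + r * y) + (t + r * t′)
    interchange = ℤSolver.solve-∀

  -- H_0 is the constant sequence λ, since C(i-1, i) = 0 for i ≥ 1
  H-zero : ∀ n → H 0 n ≡ + l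
  H-zero zero    = trans (ℤP.+-identityˡ _) (trans (ℤP.*-identityˡ _) (cong +_ (ℕP.*-identityʳ l)))
  H-zero (suc n) = begin
    H 0 n + ε (suc n) * + (l ℕ.* u q 0 (suc n))
      ≡⟨ cong₂ (λ h z → h + ε (suc n) * + (l ℕ.* (z ℕ.* q ^ suc n))) (H-zero n) (k>n⇒nCk≡0 (ℕP.n<1+n n)) ⟩
    + l + ε (suc n) * + (l ℕ.* 0)
      ≡⟨ cong (λ z → + l + ε (suc n) * + z) (ℕP.*-zeroʳ l) ⟩
    + l + ε (suc n) * + 0
      ≡⟨ trans (cong (_+_ (+ l)) (ℤP.*-zeroʳ (ε (suc n)))) (ℤP.+-identityʳ (+ l)) ⟩
    + l ∎
    where open ≡-Reasoning

  H-conv : ∀ m n → conv (H m) (w q m) n ≡ + l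
  H-conv zero    n = trans (conv-unit (H 0) (w q 0) refl (λ _ → refl) n) (H-zero n)
  H-conv (suc m) n = begin
    conv (H (suc m)) (w q (suc m)) n    ≡⟨ conv-w-suc q m (H (suc m)) n ⟩
    conv (D q (H (suc m))) (w q m) n    ≡⟨ conv-congˡ (w q m) (D-H m) n ⟩
    conv (H m) (w q m) n                ≡⟨ H-conv m n ⟩
    + l                                 ∎
    where open ≡-Reasoning

-- If g 0 = 1, the recurrence A c = l - Σ_{e<c} A e g(c-e) has only one solution, so any
-- F with F ⋆ g = l (which satisfies the same recurrence) coincides with A.
recurrence-unique : ∀ (l : ℤ) (g A F : ℕ → ℤ) → g 0 ≡ + 1 →
                    (∀ c → A c ≡ l - sumTo c (λ e → A e * g (c ∸ e))) →
                    (∀ c → conv F g c ≡ l) → ∀ c → A c ≡ F c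
recurrence-unique l g A F g₀ recA convF = <-rec (λ c → A c ≡ F c) step
  where
  solve-last : ∀ x y → y ≡ (x + y * + 1) - x
  solve-last = ℤSolver.solve-∀
  earlier : ℕ → ℤ
  earlier c = sumTo c (λ e → F e * g (c ∸ e))
  recF : ∀ c → F c ≡ l - earlier c
  recF c = begin
    F c                                   ≡⟨ solve-last (earlier c) (F c) ⟩
    (earlier c + F c * + 1) - earlier c   ≡⟨ cong (λ z → (earlier c + F c * z) - earlier c) (sym g[c∸c]≡1) ⟩
    conv F g c - earlier c                ≡⟨ cong (_- earlier c) (convF c) ⟩
    l - earlier c                         ∎
    where
    open ≡-Reasoning
    g[c∸c]≡1 : g (c ∸ c) ≡ + 1
    g[c∸c]≡1 = trans (cong g (ℕP.n∸n≡0 c)) g₀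
  step : ∀ c → (∀ {e} → e < c → A e ≡ F e) → A c ≡ F c
  step c IH = trans (recA c)
    (trans (cong (_-_ l) (sumTo-cong c (λ e e<c → cong (_* g (c ∸ e)) (IH e<c)))) (sym (recF c)))

C-pos : ∀ n k → k ≤ n → 0 < n C k
C-pos n       zero    _         = s≤s z≤n
C-pos (suc n) (suc k) (s≤s k≤n) =
  subst (0 <_) (nCk+nC[k+1]≡[n+1]C[k+1] n k) (ℕP.<-≤-trans (C-pos n k k≤n) (ℕP.m≤m+n (n C k) (n C suc k)))

-- for m ≥ 2 and q ≥ 1 they increase strictly: C(m+n, n+1) > C(m+n-1, n) as C(m+n-1, n+1) > 0
u-inc : ∀ {q m} → 1 ≤ q → 2 ≤ m → ∀ n → u q m n < u q m (suc n)
u-inc {suc q} {suc (suc m)} (s≤s z≤n) (s≤s (s≤s z≤n)) n = begin-strict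
  (suc (m ℕ.+ n) C n) ℕ.* Q
    <⟨ ℕP.m<m+n _ (ℕP.*-mono-≤ (C-pos (suc (m ℕ.+ n)) (suc n) (s≤s (ℕP.m≤n+m n m))) (ℕP.m^n>0 (suc q) n)) ⟩
  (suc (m ℕ.+ n) C n) ℕ.* Q ℕ.+ (suc (m ℕ.+ n) C suc n) ℕ.* Q
    ≡⟨ sym (ℕP.*-distribʳ-+ Q (suc (m ℕ.+ n) C n) _) ⟩
  (suc (m ℕ.+ n) C n ℕ.+ suc (m ℕ.+ n) C suc n) ℕ.* Q
    ≡⟨ cong (ℕ._* Q) (nCk+nC[k+1]≡[n+1]C[k+1] (suc (m ℕ.+ n)) n) ⟩
  (suc (suc (m ℕ.+ n)) C suc n) ℕ.* Q
    ≤⟨ ℕP.*-monoʳ-≤ (suc (suc (m ℕ.+ n)) C suc n) (ℕP.m≤n*m Q (suc q)) ⟩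
  (suc (suc (m ℕ.+ n)) C suc n) ℕ.* (suc q ℕ.* Q)
    ≡⟨ cong (λ z → (suc z C suc n) ℕ.* (suc q ℕ.* Q)) (sym (ℕP.+-suc m n)) ⟩
  u (suc q) (suc (suc m)) (suc n) ∎
  where
  open ℕP.≤-Reasoning
  Q : ℕ
  Q = suc q ^ n

recurrence-solution-distinct :
  ∀ q l m → 1 ≤ q → 1 ≤ l → 2 ≤ m → (A : ℕ → ℤ) →
  (∀ c → A c ≡ + l - sumTo c (λ e → A e * w q m (c ∸ e))) →
  (∀ c → A c ≢ + 0) × (∀ c d → A c ≡ A d → c ≡ d)
recurrence-solution-distinct q (suc l) m 1≤q (s≤s z≤n) 2≤m A recA =
  (λ c eq → altSum-nonzero L L₀-pos L-inc c (trans (sym (A≡H c)) eq)) ,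
  (λ c d eq → altSum-injective L L₀-pos L-inc c d (trans (sym (A≡H c)) (trans eq (A≡H d))))
  where
  L : ℕ → ℕ
  L i = suc l ℕ.* u q m i
  L₀-pos : 0 < L 0
  L₀-pos = s≤s z≤n
  L-inc : ∀ n → L n < L (suc n)
  L-inc n = ℕP.*-monoʳ-< (suc l) (u-inc 1≤q 2≤m n)
  A≡H : ∀ c → A c ≡ H q (suc l) m c
  A≡H = recurrence-unique (+ suc l) (w q m) A (H q (suc l) m) refl recA (H-conv q (suc l) m)

-- The statement for a_c: with q = s - 1 and m = k - t, the sequence a is a solution
-- of the recurrence above.
lemma11 : (s k t lam : ℕ) → 2 ≤ s → 1 ≤ k → t ≤ k → 1 ≤ lam → 2 ≤ k ∸ t →
          (∀ c → c ≤ t → a s k t (+ lam) c ≢ + 0) ×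
          (∀ c d → c ≤ t → d ≤ t → a s k t (+ lam) c ≡ a s k t (+ lam) d → c ≡ d)
lemma11 s@(suc (suc q)) k t lam (s≤s (s≤s z≤n)) _ _ 1≤lam 2≤m
  with recurrence-solution-distinct (suc q) lam (k ∸ t) (s≤s z≤n) 1≤lam 2≤m
         (a s k t (+ lam)) (a-recurrence s k t (+ lam))
... | nonzero , injective = (λ c _ → nonzero c) , (λ c d _ _ → injective c d)
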